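{- Let $k$ and $N$ be positive integers, and let $\omega$ be an infinite word over a finite alphabet that avoids $k$-Abelian $N$-powers (no factor of $\omega$ is a $k$-Abelian $N$-power). Then $\omega$ is arbitrarily $k$-imbalanced.
   Context: $|u|_x$ counts occurrences of $x$ as a factor of $u$; $u\sim_k v$ means $|u|_x=|v|_x$ for all non-empty $x$ with $|x|\le k$. A $k$-Abelian $N$-power is a word $U=U_1\cdots U_N$ with non-empty blocks $U_i$ satisfying $U_i\sim_k U_j$ for all $i,j$. $\omega$ is $(k,B)$-balanced if for all equal-length factors $u,v$ of $\omega$ and all words $x$ with $|x|\le k$, $\big||u|_x-|v|_x\big|\le B$; $\omega$ is arbitrarily $k$-imbalanced if it is not $(k,B)$-balanced for any positive integer $B$. -}

module Defs where

open import Data.Nat using (ℕ; zero; suc; _+_; _≤_; _<_; ∣_-_∣)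
open import Data.Fin using (Fin)
open import Data.Fin.Properties using (_≟_)
open import Data.List using (List; []; _∷_; length; concat; map; upTo)
open import Data.Bool using (Bool; true; false)
open import Data.Product using (∃; ∃-syntax; Σ; _×_; _,_)
open import Data.Vec using (Vec; lookup; toList)
open import Relation.Nullary using (¬_; does)
open import Relation.Binary.PropositionalEquality using (_≡_)

Word : ℕ → Set
Word m = List (Fin m)

InfWord : ℕ → Set
InfWord m = ℕ → Fin m

isPrefix : ∀ {m} → Word m → Word m → Bool
isPrefix [] u = true
isPrefix (a ∷ x) [] = false
isPrefix (a ∷ x) (b ∷ u) with does (a ≟ b)
... | true = isPrefix x u
... | false = false

occ : ∀ {m} → Word m → Word m → ℕ
occ [] x with isPrefix x []
... | true = 1
... | false = 0
occ (b ∷ u) x with isPrefix x (b ∷ u)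
... | true = suc (occ u x)
... | false = occ u x

_∼[_]_ : ∀ {m} → Word m → ℕ → Word m → Set
_∼[_]_ {m} u k v = (x : Word m) → 1 ≤ length x → length x ≤ k → occ u x ≡ occ v x

IsKAbelianPower : ∀ {m} → ℕ → ℕ → Word m → Set
IsKAbelianPower {m} k N U =
  Σ (Vec (Word m) N) λ Us →
    (concat (toList Us) ≡ U)
    × (∀ i → 1 ≤ length (lookup Us i))
    × (∀ i j → lookup Us i ∼[ k ] lookup Us j)

factor : ∀ {m} → InfWord m → ℕ → ℕ → Word m
factor ω i n = map (λ j → ω (i + j)) (upTo n)

AvoidsKAbelianPowers : ∀ {m} → ℕ → ℕ → InfWord m → Set
AvoidsKAbelianPowers k N ω = (i n : ℕ) → ¬ IsKAbelianPower k N (factor ω i n)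

Balanced : ∀ {m} → ℕ → ℕ → InfWord m → Set
Balanced {m} k B ω =
  (i j n : ℕ) (x : Word m) → length x ≤ k →
  ∣ occ (factor ω i n) x - occ (factor ω j n) x ∣ ≤ B

ArbitrarilyImbalanced : ∀ {m} → ℕ → InfWord m → Set
ArbitrarilyImbalanced k ω = (B : ℕ) → 1 ≤ B → ¬ Balanced k B ω

-- Suppose ω is (k, B)-balanced and fix a non-empty word x with |x| ≤ k. Let f(s, p) count the
-- occurrences of x starting in [s, s + p): it is additive in p and within B of f(0, p). With
-- h = P! and L = 2h every p ≤ P divides L, and averaging over L / p windows gives
-- |L f(0, p) − p f(0, L)| ≤ L B. Hence the potential Φ(p) = L f(0, p) − p f(0, L) + L B lies in
-- [0, 2 L B] on [0, P], and its cell ⌊Φ(p) / h⌋ takes at most 4 B + 1 values. Since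
-- Φ(s + D) − Φ(s) = L f(s, D) − D f(0, L), two ranges [s, s + D) and [s', s' + D) whose endpoints
-- lie in the same cells contain equally many occurrences of x. Colouring positions by these cells,
-- for all such x at once, van der Waerden's theorem gives N consecutive blocks of equal length
-- whose boundaries all have the same colour: a k-Abelian N-power.
module Submission where

open import Defs
open import Data.Nat using (ℕ; zero; suc; _+_; _*_; _∸_; _^_; _≤_; _<_; z≤n; s≤s; NonZero; _!; _/_; _%_; ∣_-_∣)
open import Data.Nat.Properties
open import Data.Nat.DivMod using (_mod_; m≡m%n+[m/n]*n; m%n<n; m/n*n≤m; m<n*o⇒m/o<n; m<n⇒m%n≡m)
open import Data.Nat.Divisibility using (_∣_; divides; ∣-trans; m∣m*n; m≤n⇒m!∣n!; ∣m∣n⇒∣m+n; ∣-refl)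
open import Data.Nat.Tactic.RingSolver using (solve-∀)
open import Data.Fin using (Fin; zero; suc; toℕ; fromℕ<; funToFin; finToFun; combine)
open import Data.Fin.Properties using (finToFun-funToFin; toℕ-fromℕ<; pigeonhole; combine-injective)
import Data.Fin.Properties as Finₚ
open import Data.List using (List; []; _∷_; length; map; _++_; concat; applyUpTo; allFin; cartesianProductWith)
import Data.List as List
open import Data.List.Membership.Propositional using (_∈_)
open import Data.List.Membership.Propositional.Properties using (∈-allFin; ∈-cartesianProductWith⁺)
open import Data.List.Relation.Unary.Any using (here; there; index)
open import Data.List.Relation.Unary.Any.Properties using (lookup-index)
open import Data.Vec as Vec using (Vec; toList)
open import Data.Bool using (Bool; true; false)
open import Data.Product using (∃-syntax; _×_; _,_; proj₁; proj₂)
open import Data.Sum using (_⊎_; inj₁; inj₂; [_,_]′)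
open import Data.Empty using (⊥-elim)
open import Function using (_∘_; id)
open import Relation.Nullary using (¬_; yes; no; does)
open import Relation.Binary.PropositionalEquality

funToFin-injective : ∀ {R C} {f g : Fin R → Fin C} → funToFin f ≡ funToFin g → ∀ r → f r ≡ g r
funToFin-injective {f = f} {g} eq r =
  trans (sym (finToFun-funToFin f r)) (trans (cong (λ F → finToFun F r) eq) (finToFun-funToFin g r))

-- Van der Waerden's theorem, by colour focusing

Monochromatic : ∀ {C} → (ℕ → Fin C) → (start step len : ℕ) → Set
Monochromatic χ a d len = ∀ j → j < len → χ (a + j * d) ≡ χ a

record MonochromaticAP {C} (χ : ℕ → Fin C) (W len : ℕ) : Set where
  constructor ap
  field
    start step : ℕ
    step-positive : 1 ≤ step
    step≤W : step ≤ W
    term<W : ∀ j → j < len → start + j * step < W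
    monochromatic : Monochromatic χ start step len

VanDerWaerden : ℕ → Set
VanDerWaerden len = ∀ C → ∃[ W ] ∀ (χ : ℕ → Fin C) → MonochromaticAP χ W len

shiftAP : ∀ {C} {χ : ℕ → Fin C} {W W' len} c → c + W ≤ W' →
          MonochromaticAP (χ ∘ (c +_)) W len → MonochromaticAP χ W' len
shiftAP {χ = χ} {W} {W'} {len} c c+W≤W' (ap a d d≥1 d≤W term<W mono) =
  ap (c + a) d d≥1 (≤-trans d≤W (≤-trans (m≤n+m W c) c+W≤W')) term<W' mono'
  where
  term<W' : ∀ j → j < len → c + a + j * d < W'
  term<W' j j< = subst (_< W') (sym (+-assoc c a (j * d))) (<-≤-trans (+-monoʳ-< c (term<W j j<)) c+W≤W')
  mono' : Monochromatic χ (c + a) d len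
  mono' j j< = trans (cong χ (+-assoc c a (j * d))) (mono j j<)

record Focused {C} (χ : ℕ → Fin C) (len s M : ℕ) : Set where
  field
    focus : ℕ
    focus<M : focus < M
    start step : Fin s → ℕ
    step-positive : ∀ i → 1 ≤ step i
    reaches-focus : ∀ i → start i + len * step i ≡ focus
    monochromatic : ∀ i → Monochromatic χ (start i) (step i) len
    distinct : ∀ i i' → χ (start i) ≡ χ (start i') → i ≡ i'

module _ {C} {χ : ℕ → Fin C} {len s M} (F : Focused χ len s M) where
  open Focused F

  term≤focus : ∀ i j → j ≤ len → start i + j * step i ≤ focus
  term≤focus i j j≤len =
    subst (start i + j * step i ≤_) (reaches-focus i) (+-monoʳ-≤ (start i) (*-monoˡ-≤ (step i) j≤len))


¬Focused-suc : ∀ {C} {χ : ℕ → Fin C} {len M} → ¬ Focused χ len (suc C) M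
¬Focused-suc {χ = χ} F with pigeonhole ≤-refl (χ ∘ Focused.start F)
... | i , j , i<j , same = Finₚ.<⇒≢ i<j (Focused.distinct F i j same)

module _ {C} {χ : ℕ → Fin C} {k s M} (F : Focused χ (suc k) s M) where
  open Focused F

  extend : ∀ i → χ focus ≡ χ (start i) → MonochromaticAP χ M (suc (suc k))
  extend i same = ap (start i) (step i) (step-positive i) step≤M term<M mono
    where
    step≤M : step i ≤ M
    step≤M = <⇒≤ (begin-strict
      step i                    ≤⟨ m≤n*m (step i) (suc k) ⟩
      suc k * step i            ≤⟨ m≤n+m _ (start i) ⟩
      start i + suc k * step i  ≡⟨ reaches-focus i ⟩
      focus                     <⟨ focus<M ⟩
      M                         ∎)
      where open ≤-Reasoning hiding (start)
    term<M : ∀ j → j < suc (suc k) → start i + j * step i < M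
    term<M j (s≤s j≤len) = ≤-<-trans (term≤focus F i j j≤len) focus<M
    mono : Monochromatic χ (start i) (step i) (suc (suc k))
    mono j j< with m<1+n⇒m<n∨m≡n j<
    ... | inj₁ j<len = monochromatic i j j<len
    ... | inj₂ refl = trans (cong χ (reaches-focus i)) same

-- The new family consists of the old progressions with step increased by the period g of χ,
-- together with the progression of step g starting at the old focus.
refocus : ∀ {C} {χ : ℕ → Fin C} {len s M M'} c g → 1 ≤ g → c + len * g + M ≤ M' →
          (∀ j → j < len → ∀ x → x < M → χ (c + j * g + x) ≡ χ (c + x)) →
          (F : Focused (χ ∘ (c +_)) len s M) →
          (∀ i → χ (c + Focused.focus F) ≢ χ (c + Focused.start F i)) →
          Focused χ len (suc s) M'
refocus {χ = χ} {len} {s} {M} {M'} c g g≥1 bound periodic F new = record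
  { focus = c + len * g + focus
  ; focus<M = ≤-trans (+-monoʳ-< (c + len * g) focus<M) bound
  ; start = start'
  ; step = step'
  ; step-positive = step'-positive
  ; reaches-focus = reaches'
  ; monochromatic = mono'
  ; distinct = distinct'
  }
  where
  open Focused F
  start' step' : Fin (suc s) → ℕ
  start' zero = c + focus
  start' (suc i) = c + start i
  step' zero = g
  step' (suc i) = step i + g

  step'-positive : ∀ i → 1 ≤ step' i
  step'-positive zero = g≥1
  step'-positive (suc i) = ≤-trans (step-positive i) (m≤m+n (step i) g)

  shift-out : ∀ c a j d g → c + a + j * (d + g) ≡ c + j * g + (a + j * d)
  shift-out = solve-∀

  swap-tail : ∀ c a j g → c + a + j * g ≡ c + j * g + a
  swap-tail = solve-∀

  reaches' : ∀ i → start' i + len * step' i ≡ c + len * g + focus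
  reaches' zero = swap-tail c focus len g
  reaches' (suc i) = trans (shift-out c (start i) len (step i) g)
                           (cong (c + len * g +_) (reaches-focus i))

  mono' : ∀ i → Monochromatic χ (start' i) (step' i) len
  mono' zero j j< = trans (cong χ (swap-tail c focus j g)) (periodic j j< focus focus<M)
  mono' (suc i) j j< =
    trans (cong χ (shift-out c (start i) j (step i) g))
          (trans (periodic j j< _ (≤-<-trans (term≤focus F i j (<⇒≤ j<)) focus<M)) (monochromatic i j j<))

  distinct' : ∀ i i' → χ (start' i) ≡ χ (start' i') → i ≡ i'
  distinct' zero zero _ = refl
  distinct' zero (suc i') same = ⊥-elim (new i' same)
  distinct' (suc i) zero same = ⊥-elim (new i (sym same))
  distinct' (suc i) (suc i') same = cong suc (distinct i i' same)

block-bound : ∀ M {b Y} → b ≤ Y → M * b + M ≤ M * suc Y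
block-bound M {b} b≤Y = ≤-trans (≤-reflexive (trans (+-comm (M * b) M) (sym (*-suc M b))))
                                (*-monoʳ-≤ M (s≤s b≤Y))

blockColouring : ∀ {C} M → (ℕ → Fin C) → ℕ → Fin (C ^ M)
blockColouring M χ i = funToFin (λ (o : Fin M) → χ (M * i + toℕ o))

blockColouring-≡ : ∀ {C} M (χ : ℕ → Fin C) {i i'} → blockColouring M χ i ≡ blockColouring M χ i' →
                   ∀ x → x < M → χ (M * i + x) ≡ χ (M * i' + x)
blockColouring-≡ M χ {i} {i'} same x x<M =
  subst (λ y → χ (M * i + y) ≡ χ (M * i' + y)) (toℕ-fromℕ< x<M) (funToFin-injective same (fromℕ< x<M))

focusing : ∀ {k} → VanDerWaerden (suc k) → ∀ C s →
           ∃[ M ] ∀ (χ : ℕ → Fin C) → MonochromaticAP χ M (suc (suc k)) ⊎ Focused χ (suc k) s M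
focusing vdw C zero = 1 , λ χ → inj₂ (record
  { focus = 0 ; focus<M = s≤s z≤n ; start = λ () ; step = λ () ; step-positive = λ ()
  ; reaches-focus = λ () ; monochromatic = λ () ; distinct = λ () })
focusing {k} vdw C (suc s) with focusing vdw C s
... | M , split with vdw (C ^ M)
... | W , blockAP = M * suc (W + suc k * W) , split′
  where
  Y : ℕ
  Y = W + suc k * W

  split′ : ∀ χ → MonochromaticAP χ (M * suc Y) (suc (suc k)) ⊎ Focused χ (suc k) (suc s) (M * suc Y)
  split′ χ = lift (blockAP (blockColouring M χ))
    where
    lift : MonochromaticAP (blockColouring M χ) W (suc k) →
           MonochromaticAP χ (M * suc Y) (suc (suc k)) ⊎ Focused χ (suc k) (suc s) (M * suc Y)
    lift (ap b e e≥1 e≤W term<W mono) =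
      [ inj₁ ∘ shiftAP (M * b) (block-bound M b≤Y) , grow ]′ (split (χ ∘ (M * b +_)))
      where
      b<W : b < W
      b<W = subst (_< W) (+-identityʳ b) (term<W 0 (s≤s z≤n))
      b≤Y : b ≤ Y
      b≤Y = ≤-trans (<⇒≤ b<W) (m≤m+n W _)
      rebase : ∀ j → M * b + j * (M * e) ≡ M * (b + j * e)
      rebase j = distrib M b j e
        where
        distrib : ∀ M b j e → M * b + j * (M * e) ≡ M * (b + j * e)
        distrib = solve-∀
      far≤Y : b + suc k * e ≤ Y
      far≤Y = +-mono-≤ (<⇒≤ b<W) (*-monoʳ-≤ (suc k) e≤W)

      periodic : ∀ j → j < suc k → ∀ x → x < M → χ (M * b + j * (M * e) + x) ≡ χ (M * b + x)
      periodic j j< x x<M = trans (cong (λ y → χ (y + x)) (rebase j))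
                                  (blockColouring-≡ M χ (mono j j<) x x<M)

      grow : Focused (χ ∘ (M * b +_)) (suc k) s M →
             MonochromaticAP χ (M * suc Y) (suc (suc k)) ⊎ Focused χ (suc k) (suc s) (M * suc Y)
      grow F with Finₚ.any? (λ i → χ (M * b + Focused.focus F) Finₚ.≟ χ (M * b + Focused.start F i))
      ... | yes (i , same) = inj₁ (shiftAP (M * b) (block-bound M b≤Y) (extend F i same))
      ... | no new = inj₂ (refocus (M * b) (M * e) (*-mono-≤ M≥1 e≥1)
                          (subst (λ z → z + M ≤ M * suc Y) (sym (rebase (suc k))) (block-bound M far≤Y))
                          periodic F (λ i same → new (i , same)))
        where
        M≥1 : 1 ≤ M
        M≥1 = ≤-<-trans z≤n (Focused.focus<M F)

vanDerWaerden : ∀ k → VanDerWaerden (suc k)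
vanDerWaerden zero C = 1 , λ χ → ap 0 1 ≤-refl ≤-refl
  (λ { zero _ → s≤s z≤n ; (suc j) (s≤s ()) }) (λ { zero _ → refl ; (suc j) (s≤s ()) })
vanDerWaerden (suc k) C with focusing (vanDerWaerden k) C (suc C)
... | M , split = M , λ χ → [ id , ⊥-elim ∘ ¬Focused-suc ]′ (split χ)

window : ∀ {m} → InfWord m → ℕ → ℕ → Word m
window ω s zero = []
window ω s (suc n) = ω s ∷ window ω (suc s) n

factor≡window : ∀ {m} (ω : InfWord m) s n → factor ω s n ≡ window ω s n
factor≡window ω s n = go n s id (λ j → refl)
  where
  go : ∀ n s₀ (f : ℕ → ℕ) {s} → (∀ j → s₀ + f j ≡ s + j) →
       map (λ j → ω (s₀ + j)) (applyUpTo f n) ≡ window ω s n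
  go zero s₀ f eq = refl
  go (suc n) s₀ f {s} eq = cong₂ _∷_ (cong ω (trans (eq 0) (+-identityʳ s)))
                                     (go n s₀ (f ∘ suc) (λ j → trans (eq (suc j)) (+-suc s j)))

length-window : ∀ {m} (ω : InfWord m) s n → length (window ω s n) ≡ n
length-window ω s zero = refl
length-window ω s (suc n) = cong suc (length-window ω (suc s) n)

window-+ : ∀ {m} (ω : InfWord m) s a b → window ω s (a + b) ≡ window ω s a ++ window ω (s + a) b
window-+ ω s zero b = cong (λ z → window ω z b) (sym (+-identityʳ s))
window-+ ω s (suc a) b =
  cong (ω s ∷_) (trans (window-+ ω (suc s) a b)
                       (cong (λ z → window ω (suc s) a ++ window ω z b) (sym (+-suc s a))))

indicator : Bool → ℕ
indicator true = 1
indicator false = 0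

occ-∷ : ∀ {m} (b : Fin m) u x → occ (b ∷ u) x ≡ indicator (isPrefix x (b ∷ u)) + occ u x
occ-∷ b u x with isPrefix x (b ∷ u)
... | true = refl
... | false = refl

isPrefix-++ : ∀ {m} (x u v : Word m) → length x ≤ length u → isPrefix x (u ++ v) ≡ isPrefix x u
isPrefix-++ [] u v _ = refl
isPrefix-++ (a ∷ x) (b ∷ u) v (s≤s x≤u) with does (a Finₚ.≟ b)
... | true = isPrefix-++ x u v x≤u
... | false = refl

isPrefix-longer : ∀ {m} (x u : Word m) → length u < length x → isPrefix x u ≡ false
isPrefix-longer (a ∷ x) [] _ = refl
isPrefix-longer (a ∷ x) (b ∷ u) (s≤s u<x) with does (a Finₚ.≟ b)
... | true = isPrefix-longer x u u<x
... | false = refl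

occ-longer : ∀ {m} (u x : Word m) → length u < length x → occ u x ≡ 0
occ-longer [] (a ∷ x) _ = refl
occ-longer (b ∷ u) x u<x = trans (occ-∷ b u x)
  (cong₂ _+_ (cong indicator (isPrefix-longer x (b ∷ u) u<x)) (occ-longer u x (<-trans (n<1+n _) u<x)))

occurrences : ∀ {m} → InfWord m → Word m → ℕ → ℕ → ℕ
occurrences ω x s zero = 0
occurrences ω x s (suc p) = indicator (isPrefix x (window ω s (length x))) + occurrences ω x (suc s) p

occurrences-+ : ∀ {m} (ω : InfWord m) x s a b →
                occurrences ω x s (a + b) ≡ occurrences ω x s a + occurrences ω x (s + a) b
occurrences-+ ω x s zero b = cong (λ z → occurrences ω x z b) (sym (+-identityʳ s))
occurrences-+ ω x s (suc a) b = trans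
  (cong (atStart +_) (trans (occurrences-+ ω x (suc s) a b)
                         (cong (λ z → occurrences ω x (suc s) a + occurrences ω x z b) (sym (+-suc s a)))))
  (sym (+-assoc atStart (occurrences ω x (suc s) a) _))
  where
  atStart : ℕ
  atStart = indicator (isPrefix x (window ω s (length x)))

occ-window : ∀ {m} (ω : InfWord m) c x' s p →
             occ (window ω s (p + length x')) (c ∷ x') ≡ occurrences ω (c ∷ x') s p
occ-window ω c x' s zero = occ-longer (window ω s (length x')) (c ∷ x')
  (subst (_< suc (length x')) (sym (length-window ω s (length x'))) (n<1+n _))
occ-window ω c x' s (suc p) = trans (occ-∷ (ω s) (window ω (suc s) (p + length x')) (c ∷ x'))
  (cong₂ _+_ (cong indicator prefix) (occ-window ω c x' (suc s) p))
  where
  ℓ : ℕ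
  ℓ = suc (length x')
  prefix : isPrefix (c ∷ x') (window ω s (suc p + length x')) ≡ isPrefix (c ∷ x') (window ω s ℓ)
  prefix = begin
    isPrefix (c ∷ x') (window ω s (suc p + length x'))        ≡⟨ cong (isPrefix (c ∷ x') ∘ window ω s)
                                                                  (trans (sym (+-suc p _)) (+-comm p ℓ)) ⟩
    isPrefix (c ∷ x') (window ω s (ℓ + p))                    ≡⟨ cong (isPrefix (c ∷ x')) (window-+ ω s ℓ p) ⟩
    isPrefix (c ∷ x') (window ω s ℓ ++ window ω (s + ℓ) p)    ≡⟨ isPrefix-++ (c ∷ x') _ _
                                                                  (≤-reflexive (sym (length-window ω s ℓ))) ⟩
    isPrefix (c ∷ x') (window ω s ℓ)                           ∎
    where open ≡-Reasoning

wordsUpTo : ∀ {m} → ℕ → List (Word m)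
wordsUpTo zero = [] ∷ []
wordsUpTo {m} (suc n) = [] ∷ cartesianProductWith _∷_ (allFin m) (wordsUpTo n)

∈-wordsUpTo : ∀ {m} n (x : Word m) → length x ≤ n → x ∈ wordsUpTo n
∈-wordsUpTo zero [] _ = here refl
∈-wordsUpTo (suc n) [] _ = here refl
∈-wordsUpTo (suc n) (a ∷ x) (s≤s x≤n) = there (∈-cartesianProductWith⁺ _∷_ (∈-allFin a) (∈-wordsUpTo n x x≤n))

windows : ∀ {m} → InfWord m → (s n N : ℕ) → Vec (Word m) N
windows ω s n zero = Vec.[]
windows ω s n (suc N) = window ω s n Vec.∷ windows ω (s + n) n N

concat-windows : ∀ {m} (ω : InfWord m) s n N → concat (toList (windows ω s n N)) ≡ window ω s (N * n)
concat-windows ω s n zero = refl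
concat-windows ω s n (suc N) =
  trans (cong (window ω s n ++_) (concat-windows ω (s + n) n N)) (sym (window-+ ω s n (N * n)))

lookup-windows : ∀ {m} (ω : InfWord m) s n N (i : Fin N) →
                 Vec.lookup (windows ω s n N) i ≡ window ω (s + toℕ i * n) n
lookup-windows ω s n (suc N) zero = cong (λ z → window ω z n) (sym (+-identityʳ s))
lookup-windows ω s n (suc N) (suc i) =
  trans (lookup-windows ω (s + n) n N i) (cong (λ z → window ω z n) (+-assoc s n (toℕ i * n)))

windows-power : ∀ {m} (ω : InfWord m) {k} s n N → 1 ≤ n →
                (∀ t t' → t < N → t' < N → window ω (s + t * n) n ∼[ k ] window ω (s + t' * n) n) →
                IsKAbelianPower k N (factor ω s (N * n))
windows-power ω s n N n≥1 equivalent =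
  windows ω s n N ,
  trans (concat-windows ω s n N) (sym (factor≡window ω s (N * n))) ,
  (λ i → subst (λ w → 1 ≤ length w) (sym (lookup-windows ω s n N i))
                (subst (1 ≤_) (sym (length-window ω _ n)) n≥1)) ,
  λ i j → subst₂ (_∼[ _ ]_) (sym (lookup-windows ω s n N i)) (sym (lookup-windows ω s n N j))
                 (equivalent (toℕ i) (toℕ j) (Finₚ.toℕ<n i) (Finₚ.toℕ<n j))

-- Balanced additive counts

div-≡⇒< : ∀ h .{{_ : NonZero h}} a b → a / h ≡ b / h → a < b + h
div-≡⇒< h a b eq = begin-strict
  a                    ≡⟨ m≡m%n+[m/n]*n a h ⟩
  a % h + (a / h) * h  <⟨ +-monoˡ-< _ (m%n<n a h) ⟩
  h + (a / h) * h      ≡⟨ cong (λ z → h + z * h) eq ⟩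
  h + (b / h) * h      ≤⟨ +-monoʳ-≤ h (m/n*n≤m b h) ⟩
  h + b                ≡⟨ +-comm h b ⟩
  b + h                ∎
  where open ≤-Reasoning

mod-injective : ∀ n .{{_ : NonZero n}} {a b} → a < n → b < n → a mod n ≡ b mod n → a ≡ b
mod-injective n {a} {b} a<n b<n eq = begin
  a             ≡⟨ sym (m<n⇒m%n≡m a<n) ⟩
  a % n         ≡⟨ sym (toℕ-fromℕ< (m%n<n a n)) ⟩
  toℕ (a mod n) ≡⟨ cong toℕ eq ⟩
  toℕ (b mod n) ≡⟨ toℕ-fromℕ< (m%n<n b n) ⟩
  b % n         ≡⟨ m<n⇒m%n≡m b<n ⟩
  b             ∎
  where open ≡-Reasoning

increment-mono : ∀ h {a₁ a₂ b₁ b₂ z t₁ t₂} →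
                 a₁ + z ≡ b₁ + (h + h) * t₁ → a₂ + z ≡ b₂ + (h + h) * t₂ →
                 a₂ < a₁ + h → b₁ < b₂ + h → t₂ ≤ t₁
increment-mono h {a₁} {a₂} {b₁} {b₂} {z} {t₁} {t₂} e₁ e₂ a₂< b₁< = ≮⇒≥ λ t₁<t₂ →
  <-irrefl refl (<-≤-trans sum< (+-cancelʳ-≤ (z + L * t₁) _ _ (sum≤ t₁<t₂)))
  where
  L : ℕ
  L = h + h
  sum< : a₂ + b₁ < b₂ + L + a₁
  sum< = subst (a₂ + b₁ <_) (regroup₁ a₁ h b₂) (+-mono-< a₂< b₁<)
    where
    regroup₁ : ∀ a h b → (a + h) + (b + h) ≡ b + (h + h) + a
    regroup₁ = solve-∀
  sum≤ : t₁ < t₂ → b₂ + L + a₁ + (z + L * t₁) ≤ a₂ + b₁ + (z + L * t₁)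
  sum≤ t₁<t₂ = begin
    b₂ + L + a₁ + (z + L * t₁)      ≡⟨ regroup₂ b₂ L t₁ a₁ z ⟩
    (b₂ + L * suc t₁) + (a₁ + z)    ≤⟨ +-monoˡ-≤ (a₁ + z) (+-monoʳ-≤ b₂ (*-monoʳ-≤ L t₁<t₂)) ⟩
    (b₂ + L * t₂) + (a₁ + z)        ≡⟨ cong₂ _+_ (sym e₂) e₁ ⟩
    (a₂ + z) + (b₁ + L * t₁)        ≡⟨ regroup₃ a₂ z b₁ L t₁ ⟩
    a₂ + b₁ + (z + L * t₁)          ∎
    where
    open ≤-Reasoning
    regroup₂ : ∀ b L t a z → b + L + a + (z + L * t) ≡ (b + L * suc t) + (a + z)
    regroup₂ = solve-∀
    regroup₃ : ∀ a z b L t → (a + z) + (b + L * t) ≡ a + b + (z + L * t)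
    regroup₃ = solve-∀

increment-rigid : ∀ h {a₁ a₂ b₁ b₂ z t₁ t₂} →
                  a₁ + z ≡ b₁ + (h + h) * t₁ → a₂ + z ≡ b₂ + (h + h) * t₂ →
                  a₁ < a₂ + h → a₂ < a₁ + h → b₁ < b₂ + h → b₂ < b₁ + h → t₁ ≡ t₂
increment-rigid h e₁ e₂ a₁< a₂< b₁< b₂< =
  ≤-antisym (increment-mono h e₂ e₁ a₁< b₂<) (increment-mono h e₁ e₂ a₂< b₁<)

module BalancedCounts (f : ℕ → ℕ → ℕ) (f-+ : ∀ s a b → f s (a + b) ≡ f s a + f (s + a) b)
                      (B : ℕ) (balanced : ∀ s p → ∣ f s p - f 0 p ∣ ≤ B) where

  f-zero : ∀ s → f s 0 ≡ 0
  f-zero s = subst (λ t → f t 0 ≡ 0) (+-identityʳ s)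
                   (+-cancelˡ-≡ (f s 0) _ 0 (trans (sym (f-+ s 0 0)) (sym (+-identityʳ (f s 0)))))

  f≤f₀+B : ∀ s p → f s p ≤ f 0 p + B
  f≤f₀+B s p = ≤-trans (m≤∣m-n∣+n (f s p) (f 0 p))
                       (subst (_≤ f 0 p + B) (+-comm (f 0 p) _) (+-monoʳ-≤ (f 0 p) (balanced s p)))

  f₀≤f+B : ∀ s p → f 0 p ≤ f s p + B
  f₀≤f+B s p = ≤-trans (m≤n+∣n-m∣ (f 0 p) (f s p)) (+-monoʳ-≤ (f s p) (balanced s p))

  private
    interchange : ∀ a b c d → (a + b) + (c + d) ≡ (a + c) + (b + d)
    interchange = solve-∀

  f-*-upper : ∀ p q s → f s (q * p) ≤ q * f 0 p + q * B
  f-*-upper p zero s = ≤-reflexive (f-zero s)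
  f-*-upper p (suc q) s = begin
    f s (p + q * p)                               ≡⟨ f-+ s p (q * p) ⟩
    f s p + f (s + p) (q * p)                     ≤⟨ +-mono-≤ (f≤f₀+B s p) (f-*-upper p q (s + p)) ⟩
    (f 0 p + B) + (q * f 0 p + q * B)             ≡⟨ interchange (f 0 p) B _ _ ⟩
    (f 0 p + q * f 0 p) + (B + q * B)             ∎
    where open ≤-Reasoning

  f-*-lower : ∀ p q s → q * f 0 p ≤ f s (q * p) + q * B
  f-*-lower p zero s = z≤n
  f-*-lower p (suc q) s = begin
    f 0 p + q * f 0 p                              ≤⟨ +-mono-≤ (f₀≤f+B s p) (f-*-lower p q (s + p)) ⟩
    (f s p + B) + (f (s + p) (q * p) + q * B)      ≡⟨ interchange (f s p) B _ _ ⟩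
    (f s p + f (s + p) (q * p)) + (B + q * B)      ≡⟨ cong (_+ (B + q * B)) (sym (f-+ s p (q * p))) ⟩
    f s (p + q * p) + (B + q * B)                  ∎
    where open ≤-Reasoning

  -- averaging over L / p windows of length p
  ∣⇒f₀-bounds : ∀ {p L} → p ∣ L → (p * f 0 L ≤ L * f 0 p + L * B) × (L * f 0 p ≤ p * f 0 L + L * B)
  ∣⇒f₀-bounds {p} (divides q refl) =
    subst (p * f 0 (q * p) ≤_) (distribute p q (f 0 p) B) (*-monoʳ-≤ p (f-*-upper p q 0)) ,
    subst₂ _≤_ (reassoc p q (f 0 p)) (distribute′ p q (f 0 (q * p)) B) (*-monoʳ-≤ p (f-*-lower p q 0))
    where
    distribute : ∀ p q a b → p * (q * a + q * b) ≡ q * p * a + q * p * b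
    distribute = solve-∀
    reassoc : ∀ p q a → p * (q * a) ≡ q * p * a
    reassoc = solve-∀
    distribute′ : ∀ p q a b → p * (a + q * b) ≡ p * a + q * p * b
    distribute′ = solve-∀

module Cells (f : ℕ → ℕ → ℕ) (B P : ℕ) where
  h : ℕ
  h = P !

  instance
    h≢0 : NonZero h
    h≢0 = P !≢0

  L : ℕ
  L = h + h

  potential : ℕ → ℕ
  potential p = L * f 0 p + L * B ∸ p * f 0 L

  cell : ℕ → Fin (suc (4 * B))
  cell p = (potential p / h) mod suc (4 * B)

  module _ (f-+ : ∀ s a b → f s (a + b) ≡ f s a + f (s + a) b)
           (balanced : ∀ s p → ∣ f s p - f 0 p ∣ ≤ B) where
    open BalancedCounts f f-+ B balanced

    -- every p ≤ P divides L, so f₀ is almost linear on [0, P]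
    f₀-almost-linear : ∀ {p} → p ≤ P → (p * f 0 L ≤ L * f 0 p + L * B) × (L * f 0 p ≤ p * f 0 L + L * B)
    f₀-almost-linear {zero} _ = z≤n , ≤-trans (≤-reflexive (trans (cong (L *_) (f-zero 0)) (*-zeroʳ L))) z≤n
    f₀-almost-linear {suc p} p≤P =
      ∣⇒f₀-bounds (∣-trans (∣-trans (m∣m*n (p !)) (m≤n⇒m!∣n! p≤P)) (∣m∣n⇒∣m+n ∣-refl ∣-refl))

    potential-+ : ∀ {p} → p ≤ P → potential p + p * f 0 L ≡ L * f 0 p + L * B
    potential-+ p≤P = m∸n+n≡m (proj₁ (f₀-almost-linear p≤P))

    potential/h< : ∀ {p} → p ≤ P → potential p / h < suc (4 * B)
    potential/h< {p} p≤P = m<n*o⇒m/o<n (begin-strict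
      L * f 0 p + L * B ∸ p * f 0 L                  ≤⟨ ∸-monoˡ-≤ (p * f 0 L)
                                                          (+-monoˡ-≤ (L * B) (proj₂ (f₀-almost-linear p≤P))) ⟩
      p * f 0 L + L * B + L * B ∸ p * f 0 L          ≡⟨ cong (_∸ p * f 0 L) (+-assoc (p * f 0 L) _ _) ⟩
      p * f 0 L + (L * B + L * B) ∸ p * f 0 L        ≡⟨ m+n∸m≡n (p * f 0 L) _ ⟩
      L * B + L * B                                  ≡⟨ four h B ⟩
      4 * B * h                                      <⟨ m<n+m (4 * B * h) (1≤n! P) ⟩
      h + 4 * B * h                                  ∎)
      where
      open ≤-Reasoning
      four : ∀ h B → (h + h) * B + (h + h) * B ≡ 4 * B * h
      four = solve-∀

    cell-≡⇒< : ∀ {p q} → p ≤ P → q ≤ P → cell p ≡ cell q → potential p < potential q + h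
    cell-≡⇒< p≤P q≤P same =
      div-≡⇒< h _ _ (mod-injective (suc (4 * B)) (potential/h< p≤P) (potential/h< q≤P) same)

    potential-increment : ∀ s D → s + D ≤ P → potential (s + D) + D * f 0 L ≡ potential s + L * f s D
    potential-increment s D s+D≤P = +-cancelʳ-≡ (s * f 0 L) _ _ (begin
      potential (s + D) + D * f 0 L + s * f 0 L  ≡⟨ regroup₁ (potential (s + D)) D s (f 0 L) ⟩
      potential (s + D) + (s + D) * f 0 L        ≡⟨ potential-+ s+D≤P ⟩
      L * f 0 (s + D) + L * B                    ≡⟨ cong (λ z → L * z + L * B) (f-+ 0 s D) ⟩
      L * (f 0 s + f s D) + L * B                ≡⟨ regroup₂ L (f 0 s) (f s D) B ⟩
      L * f 0 s + L * B + L * f s D              ≡⟨ cong (_+ L * f s D) (sym (potential-+ s≤P)) ⟩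
      potential s + s * f 0 L + L * f s D        ≡⟨ regroup₃ (potential s) s (f 0 L) L (f s D) ⟩
      potential s + L * f s D + s * f 0 L        ∎)
      where
      open ≡-Reasoning
      s≤P : s ≤ P
      s≤P = ≤-trans (m≤m+n s D) s+D≤P
      regroup₁ : ∀ x D s q → x + D * q + s * q ≡ x + (s + D) * q
      regroup₁ = solve-∀
      regroup₂ : ∀ L a c B → L * (a + c) + L * B ≡ L * a + L * B + L * c
      regroup₂ = solve-∀
      regroup₃ : ∀ x s q L c → x + s * q + L * c ≡ x + L * c + s * q
      regroup₃ = solve-∀

    increments-≡ : ∀ {s s' D} → s + D ≤ P → s' + D ≤ P →
                   cell s ≡ cell s' → cell (s + D) ≡ cell (s' + D) → f s D ≡ f s' D
    increments-≡ {s} {s'} {D} end≤P end'≤P start-cells end-cells = increment-rigid h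
      (potential-increment s D end≤P) (potential-increment s' D end'≤P)
      (cell-≡⇒< end≤P end'≤P end-cells) (cell-≡⇒< end'≤P end≤P (sym end-cells))
      (cell-≡⇒< start≤P start'≤P start-cells) (cell-≡⇒< start'≤P start≤P (sym start-cells))
      where
      start≤P : s ≤ P
      start≤P = ≤-trans (m≤m+n s D) end≤P
      start'≤P : s' ≤ P
      start'≤P = ≤-trans (m≤m+n s' D) end'≤P

-- Balanced words contain Abelian powers

occurrences-balanced : ∀ {m k B} {ω : InfWord m} → Balanced k B ω → ∀ c x' → suc (length x') ≤ k →
                       ∀ s p → ∣ occurrences ω (c ∷ x') s p - occurrences ω (c ∷ x') 0 p ∣ ≤ B
occurrences-balanced {ω = ω} balanced c x' x≤k s p =
  subst₂ (λ u v → ∣ u - v ∣ ≤ _) (counts s) (counts 0) (balanced s 0 (p + length x') (c ∷ x') x≤k)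
  where
  counts : ∀ s → occ (factor ω s (p + length x')) (c ∷ x') ≡ occurrences ω (c ∷ x') s p
  counts s = trans (cong (λ w → occ w (c ∷ x')) (factor≡window ω s (p + length x'))) (occ-window ω c x' s p)

module Colouring {m} (ω : InfWord m) (k B : ℕ) where
  C : ℕ
  C = suc (4 * B)

  Colours : ℕ
  Colours = (C * C) ^ length (wordsUpTo {m} k)

  module WordCells (P : ℕ) (x : Word m) = Cells (occurrences ω x) B P

  module _ (P : ℕ) where
    open WordCells P using (cell) public

    -- k i is a block boundary; an occurrence of x = c ∷ x' in a block ending there starts before k i ∸ |x'|
    wordColour : Word m → ℕ → Fin (C * C)
    wordColour x i = combine (cell x (k * i)) (cell x (k * i ∸ (length x ∸ 1)))

    colour : ℕ → Fin Colours
    colour i = funToFin (λ r → wordColour (List.lookup (wordsUpTo k) r) i)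

    colour-≡ : ∀ {i j} x → length x ≤ k → colour i ≡ colour j →
               cell x (k * i) ≡ cell x (k * j) ×
               cell x (k * i ∸ (length x ∸ 1)) ≡ cell x (k * j ∸ (length x ∸ 1))
    colour-≡ {i} {j} x x≤k same = combine-injective _ _ _ _
      (subst (λ y → wordColour y i ≡ wordColour y j) (sym (lookup-index x∈))
             (funToFin-injective same (index x∈)))
      where x∈ = ∈-wordsUpTo k x x≤k

module MonochromaticBlocks {m k B N W} {ω : InfWord m} (1≤k : 1 ≤ k) (balanced : Balanced k B ω)
                           (AP : MonochromaticAP (Colouring.colour ω k B (k * W)) W (suc N)) where
  open MonochromaticAP AP renaming (start to a; step to d)
  open Colouring ω k B
  P : ℕ
  P = k * W

  n : ℕ
  n = k * d

  blockStart : ℕ → ℕ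
  blockStart t = k * a + t * n

  k≤n : k ≤ n
  k≤n = subst (_≤ n) (*-identityʳ k) (*-monoʳ-≤ k step-positive)

  term-start : ∀ t → k * (a + t * d) ≡ blockStart t
  term-start t = expand k a t d
    where
    expand : ∀ k a t d → k * (a + t * d) ≡ k * a + t * (k * d)
    expand = solve-∀

  term-end : ∀ t → k * (a + suc t * d) ≡ blockStart t + n
  term-end t = expand k a t d
    where
    expand : ∀ k a t d → k * (a + suc t * d) ≡ k * a + t * (k * d) + k * d
    expand = solve-∀

  module _ (c : Fin m) (x' : Word m) (x≤k : suc (length x') ≤ k) where
    x : Word m
    x = c ∷ x'
    ℓ : ℕ
    ℓ = length x'
    ℓ≤n : ℓ ≤ n
    ℓ≤n = ≤-trans (n≤1+n ℓ) (≤-trans x≤k k≤n)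
    D : ℕ
    D = n ∸ ℓ

    open WordCells P x using (increments-≡)

    occ-block : ∀ t → occ (window ω (blockStart t) n) x ≡ occurrences ω x (blockStart t) D
    occ-block t = trans (cong (λ z → occ (window ω (blockStart t) z) x) (sym (m∸n+n≡m ℓ≤n)))
                        (occ-window ω c x' (blockStart t) D)

    end≡ : ∀ t → k * (a + suc t * d) ∸ ℓ ≡ blockStart t + D
    end≡ t = trans (cong (_∸ ℓ) (term-end t)) (+-∸-assoc (blockStart t) ℓ≤n)

    end≤ : ∀ t → t < N → blockStart t + D ≤ P
    end≤ t t<N = begin
      blockStart t + D      ≤⟨ +-monoʳ-≤ (blockStart t) (m∸n≤m n ℓ) ⟩
      blockStart t + n      ≡⟨ sym (term-end t) ⟩
      k * (a + suc t * d)   ≤⟨ *-monoʳ-≤ k (<⇒≤ (term<W (suc t) (s≤s t<N))) ⟩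
      P                     ∎
      where open ≤-Reasoning

    start-cell : ∀ t → t < N → cell P x (blockStart t) ≡ cell P x (k * a)
    start-cell t t<N = subst (λ z → cell P x z ≡ cell P x (k * a)) (term-start t)
      (proj₁ (colour-≡ P x x≤k (monochromatic t (≤-trans t<N (n≤1+n N)))))

    end-cell : ∀ t → t < N → cell P x (blockStart t + D) ≡ cell P x (k * a ∸ ℓ)
    end-cell t t<N = subst (λ z → cell P x z ≡ cell P x (k * a ∸ ℓ)) (end≡ t)
      (proj₂ (colour-≡ P x x≤k (monochromatic (suc t) (s≤s t<N))))

    occ-blocks-≡ : ∀ t t' → t < N → t' < N →
                   occ (window ω (blockStart t) n) x ≡ occ (window ω (blockStart t') n) x
    occ-blocks-≡ t t' t<N t'<N = begin
      occ (window ω (blockStart t) n) x    ≡⟨ occ-block t ⟩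
      occurrences ω x (blockStart t) D     ≡⟨ increments-≡ (occurrences-+ ω x) (occurrences-balanced balanced c x' x≤k)
                                                {blockStart t} {blockStart t'} (end≤ t t<N) (end≤ t' t'<N)
                                                (trans (start-cell t t<N) (sym (start-cell t' t'<N)))
                                                (trans (end-cell t t<N) (sym (end-cell t' t'<N))) ⟩
      occurrences ω x (blockStart t') D    ≡⟨ sym (occ-block t') ⟩
      occ (window ω (blockStart t') n) x   ∎
      where open ≡-Reasoning

  power : IsKAbelianPower k N (factor ω (k * a) (N * n))
  power = windows-power ω (k * a) n N (≤-trans 1≤k k≤n) equivalent
    where
    equivalent : ∀ t t' → t < N → t' < N → window ω (blockStart t) n ∼[ k ] window ω (blockStart t') n
    equivalent t t' t<N t'<N [] ()
    equivalent t t' t<N t'<N (c ∷ x') _ x≤k = occ-blocks-≡ c x' x≤k t t' t<N t'<N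

balanced⇒power : ∀ {m k B} N (ω : InfWord m) → 1 ≤ k → Balanced k B ω →
                 ∃[ s ] ∃[ n ] IsKAbelianPower k N (factor ω s n)
balanced⇒power {k = k} {B} N ω 1≤k balanced with vanDerWaerden N (Colouring.Colours ω k B)
... | W , monochromaticAP =
  _ , _ , MonochromaticBlocks.power 1≤k balanced (monochromaticAP (Colouring.colour ω k B (k * W)))

corollary30 : (m k N : ℕ) → 1 ≤ k → 1 ≤ N → (ω : InfWord m) →
    AvoidsKAbelianPowers k N ω → ArbitrarilyImbalanced k ω
corollary30 m k N 1≤k _ ω avoids B _ balanced with balanced⇒power N ω 1≤k balanced
... | s , n , power = avoids s n power
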